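{- Let $n,k$ be integers with $k\ge1$, $n>2k$. Then $\beta(P(n,k))\ge n+2$ if and only if none of the following holds: (a) $n$ is even and $k$ is odd; (b) $n$ is odd and $k=1$; (c) $n=5$ and $k=2$.
   Context: $P(n,k)$ is the generalized Petersen graph with vertices $u_1,\dots,u_n,v_1,\dots,v_n$ and edges $u_iu_{i+1}$, $u_iv_i$, $v_iv_{i+k}$ (subscripts modulo $n$). $\beta(G)$ denotes the size of a minimum vertex cover of $G$. -}

module Defs where

open import Data.Nat using (ℕ; zero; suc; _+_; _%_; NonZero)
open import Data.Fin using (Fin; fromℕ<; _↑ˡ_; _↑ʳ_)
open import Data.Fin.Subset using (Subset; _∈_; ∣_∣)
open import Data.Nat.DivMod using (_mod_)
open import Data.List using (List; []; _∷_; _++_; concatMap; allFin)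
open import Data.List.Relation.Unary.All using (All)
open import Data.Product using (_×_; _,_)
open import Data.Sum using (_⊎_)

_⊕[_]_ : ℕ → (n : ℕ) → ℕ → {{NonZero n}} → Fin n
(i ⊕[ n ] j) = (i + j) mod n

u : {n : ℕ} → Fin n → Fin (n + n)
u {n} i = i ↑ˡ n

v : {n : ℕ} → Fin n → Fin (n + n)
v {n} i = n ↑ʳ i

petersenEdges : (n k : ℕ) → {{NonZero n}} → List (Fin (n + n) × Fin (n + n))
petersenEdges n k = concatMap edgesAt (allFin n)
  where
  edgesAt : Fin n → List (Fin (n + n) × Fin (n + n))
  edgesAt i = (u i , u (Data.Fin.toℕ i ⊕[ n ] 1))
            ∷ (u i , v i)
            ∷ (v i , v (Data.Fin.toℕ i ⊕[ n ] k))
            ∷ []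

IsVertexCover : {m : ℕ} → List (Fin m × Fin m) → Subset m → Set
IsVertexCover E S = All (λ e → (Data.Product.proj₁ e ∈ S) ⊎ (Data.Product.proj₂ e ∈ S)) E

βP≥ : (n k : ℕ) → {{NonZero n}} → ℕ → Set
βP≥ n k m = (S : Subset (n + n)) → IsVertexCover (petersenEdges n k) S → m Data.Nat.≤ ∣ S ∣

module Submission where

-- A vertex cover S is read as two n-periodic boolean sequences, outer x (u_x ∈ S) and
-- inner x (v_x ∈ S). Counting the rim edges u_x u_(x+1), the spokes u_x v_x and the hub
-- edges v_x v_(x+k) by their ends gives |S| = n + #spoke and #rim + #hub = 2 · #spoke,
-- where #e counts the edges of kind e with both ends in S; moreover #rim ≡ n (mod 2).
-- So if #spoke ≤ 1 there are at most two doubly covered rim edges, between them the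
-- outer sequence alternates (its values are the parities of the offsets), and outer
-- vertices missing at hub distance force doubly covered hub edges; a case analysis on
-- the parities of n and k leaves only the exceptional pairs. Each exceptional pair in
-- turn has an explicit cover with at most n + 1 vertices.

open import Data.Bool using (Bool; true; false; not; _∧_; _∨_; _xor_; T)
open import Data.Bool.Properties
  using (∨-zeroʳ; ∨-inverseˡ; ∨-inverseʳ; ∧-zeroʳ; ∧-identityʳ; ∧-inverseʳ; not-involutive;
         not-distribˡ-xor; not-distribʳ-xor; xor-identityʳ; xor-comm; xor-same; ¬-not; not-¬)
open import Data.Empty using (⊥; ⊥-elim)
open import Data.Fin using (Fin; zero; suc; toℕ; _↑ˡ_; _↑ʳ_)
open import Data.Fin.Properties using (toℕ-injective; toℕ-fromℕ<; toℕ<n)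
open import Data.Fin.Subset using (Subset; _∈_) renaming (∣_∣ to size)
open import Data.Fin.Subset.Properties using (_∈?_)
open import Data.List using (List; []; _∷_; length)
open import Data.List.Membership.Propositional.Properties using (∈-allFin)
open import Data.List.Relation.Unary.All using (All; []; _∷_; all?)
import Data.List.Relation.Unary.All as All
open import Data.List.Relation.Unary.All.Properties using (concat⁻; concat⁺; map⁻; map⁺; tabulate⁺)
open import Data.List.Relation.Unary.AllPairs using (AllPairs; []; _∷_)
open import Data.Nat
open import Data.Nat.DivMod
  using (_mod_; m≡m%n+[m/n]*n; m%n<n; %-distribˡ-+; m%n%n≡m%n; m<n⇒m%n≡m; [m+n]%n≡m%n; n%n≡0)
open import Data.Nat.Divisibility using (_∣_; divides; ∣m∣n⇒∣m+n; ∣-refl)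
open import Data.Nat.Properties
open import Algebra.Properties.CommutativeSemigroup +-commutativeSemigroup
  using (interchange; x∙yz≈y∙xz; x∙yz≈xz∙y; xy∙z≈xz∙y)
open import Data.Nat.Tactic.RingSolver using (solve-∀)
open import Data.Product using (∃; _×_; _,_; proj₁; proj₂)
open import Data.Sum using (_⊎_; inj₁; inj₂)
open import Data.Unit using (tt)
open import Data.Vec using (Vec; []; _∷_; lookup; tabulate; _++_)
open import Data.Vec.Properties using ([]=⇒lookup; lookup⇒[]=; lookup-++ˡ; lookup-++ʳ; lookup∘tabulate)
open import Defs
open import Function using (_∘_)
open import Function.Bundles using (_⇔_; mk⇔)
open import Relation.Binary.PropositionalEquality
open import Relation.Nullary using (¬_; Dec; yes; no)
open import Relation.Nullary.Decidable using (_×-dec_; _⊎-dec_; toWitness)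

⟦_⟧ : Bool → ℕ
⟦ true ⟧  = 1
⟦ false ⟧ = 0

count : ℕ → (ℕ → Bool) → ℕ
count zero    g = 0
count (suc m) g = ⟦ g 0 ⟧ + count m (g ∘ suc)

count-cong : ∀ m {g h : ℕ → Bool} → (∀ x → g x ≡ h x) → count m g ≡ count m h
count-cong zero    eq = refl
count-cong (suc m) eq = cong₂ _+_ (cong ⟦_⟧ (eq 0)) (count-cong m (eq ∘ suc))

count-snoc : ∀ m g → count (suc m) g ≡ count m g + ⟦ g m ⟧
count-snoc zero    g = +-comm ⟦ g 0 ⟧ 0
count-snoc (suc m) g = begin
  ⟦ g 0 ⟧ + count (suc m) (g ∘ suc)      ≡⟨ cong (⟦ g 0 ⟧ +_) (count-snoc m (g ∘ suc)) ⟩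
  ⟦ g 0 ⟧ + (count m (g ∘ suc) + ⟦ g (suc m) ⟧) ≡⟨ +-assoc ⟦ g 0 ⟧ _ _ ⟨
  count (suc m) g + ⟦ g (suc m) ⟧           ∎
  where open ≡-Reasoning

count-∨ : ∀ m (a b : ℕ → Bool) → (∀ x → a x ∨ b x ≡ true) →
          count m a + count m b ≡ m + count m (λ x → a x ∧ b x)
count-∨ zero    a b cov = refl
count-∨ (suc m) a b cov = begin
  ⟦ a 0 ⟧ + count m (a ∘ suc) + (⟦ b 0 ⟧ + count m (b ∘ suc))
    ≡⟨ interchange ⟦ a 0 ⟧ _ ⟦ b 0 ⟧ _ ⟩
  (⟦ a 0 ⟧ + ⟦ b 0 ⟧) + (count m (a ∘ suc) + count m (b ∘ suc))
    ≡⟨ cong₂ _+_ (local (a 0) (b 0) (cov 0)) (count-∨ m (a ∘ suc) (b ∘ suc) (cov ∘ suc)) ⟩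
  suc ⟦ a 0 ∧ b 0 ⟧ + (m + count m (λ x → a (suc x) ∧ b (suc x)))
    ≡⟨ cong suc (x∙yz≈y∙xz ⟦ a 0 ∧ b 0 ⟧ m _) ⟩
  suc m + count (suc m) (λ x → a x ∧ b x) ∎
  where
  open ≡-Reasoning
  local : ∀ x y → x ∨ y ≡ true → ⟦ x ⟧ + ⟦ y ⟧ ≡ suc ⟦ x ∧ y ⟧
  local true  true  _ = refl
  local true  false _ = refl
  local false true  _ = refl

count-mono : ∀ m {g h : ℕ → Bool} → (∀ x → g x ≡ true → h x ≡ true) → count m g ≤ count m h
count-mono zero    imp = z≤n
count-mono (suc m) {g} {h} imp = +-mono-≤ (pointwise (g 0) (h 0) (imp 0)) (count-mono m (imp ∘ suc))
  where
  pointwise : ∀ x y → (x ≡ true → y ≡ true) → ⟦ x ⟧ ≤ ⟦ y ⟧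
  pointwise false y _ = z≤n
  pointwise true  y i = ≤-reflexive (cong ⟦_⟧ (sym (i refl)))

count-false : ∀ m → count m (λ _ → false) ≡ 0
count-false zero    = refl
count-false (suc m) = count-false m

count-complement : ∀ m g → count m g + count m (not ∘ g) ≡ m
count-complement m g = begin
  count m g + count m (not ∘ g)              ≡⟨ count-∨ m g (not ∘ g) (∨-inverseʳ ∘ g) ⟩
  m + count m (λ x → g x ∧ not (g x))        ≡⟨ cong (m +_) (count-cong m (∧-inverseʳ ∘ g)) ⟩
  m + count m (λ _ → false)                  ≡⟨ cong (m +_) (count-false m) ⟩
  m + 0                                      ≡⟨ +-identityʳ m ⟩
  m ∎
  where open ≡-Reasoning

_without_ : (ℕ → Bool) → ℕ → (ℕ → Bool)
(g without x) y = g y ∧ not (y ≡ᵇ x)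

without-≢ : ∀ g {x y} → y ≢ x → g y ≡ true → (g without x) y ≡ true
without-≢ g {x} {y} y≢x gy with y ≡ᵇ x in eq
... | true  = ⊥-elim (y≢x (≡ᵇ⇒≡ y x (subst T (sym eq) _)))
... | false = trans (∧-identityʳ (g y)) gy

count-without : ∀ m g x → x < m → g x ≡ true → count m g ≡ suc (count m (g without x))
count-without (suc m) g zero    _ g0 = begin
  ⟦ g 0 ⟧ + count m (g ∘ suc)                   ≡⟨ cong₂ _+_ (cong ⟦_⟧ g0) (count-cong m (λ y → sym (∧-identityʳ (g (suc y))))) ⟩
  suc (count m ((g without 0) ∘ suc))           ≡⟨ cong (λ b → suc (⟦ b ⟧ + count m ((g without 0) ∘ suc))) (sym (∧-zeroʳ (g 0))) ⟩
  suc (count (suc m) (g without 0))             ∎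
  where open ≡-Reasoning
count-without (suc m) g (suc x) (s≤s x<m) gx = begin
  ⟦ g 0 ⟧ + count m (g ∘ suc)                   ≡⟨ cong (⟦ g 0 ⟧ +_) (count-without m (g ∘ suc) x x<m gx) ⟩
  ⟦ g 0 ⟧ + suc (count m ((g ∘ suc) without x)) ≡⟨ +-suc ⟦ g 0 ⟧ _ ⟩
  suc (⟦ g 0 ⟧ + count m ((g ∘ suc) without x)) ≡⟨ cong (λ b → suc (⟦ b ⟧ + count m ((g ∘ suc) without x))) (sym (∧-identityʳ (g 0))) ⟩
  suc (count (suc m) (g without suc x))         ∎
  where open ≡-Reasoning

count-distinct : ∀ m g (xs : List ℕ) → AllPairs _≢_ xs → All (_< m) xs →
                 All (λ x → g x ≡ true) xs → length xs ≤ count m g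
count-distinct m g []       _            _            _          = z≤n
count-distinct m g (x ∷ xs) (x≢ ∷ dist) (x<m ∷ xs<m) (gx ∷ gxs) =
  subst (suc (length xs) ≤_) (sym (count-without m g x x<m gx))
    (s≤s (count-distinct m (g without x) xs dist xs<m (All.zipWith off (x≢ , gxs))))
  where
  off : ∀ {y} → x ≢ y × g y ≡ true → (g without x) y ≡ true
  off (x≢y , gy) = without-≢ g (x≢y ∘ sym) gy

count-witness : ∀ m g → 1 ≤ count m g → ∃ λ x → x < m × g x ≡ true
count-witness (suc m) g pos with g 0 in g0
... | true  = 0 , s≤s z≤n , g0
... | false with count-witness m (g ∘ suc) pos
...   | x , x<m , gx = suc x , s≤s x<m , gx

Periodic : ℕ → (ℕ → Bool) → Set
Periodic m g = ∀ x → g (x + m) ≡ g x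

count-window : ∀ m g → Periodic m g → ∀ c → count m (λ x → g (c + x)) ≡ count m g
count-window m g per zero    = refl
count-window m g per (suc c) = trans (count-window m (g ∘ suc) (per ∘ suc) c) shift
  where
  shift : count m (g ∘ suc) ≡ count m g
  shift = +-cancelˡ-≡ ⟦ g 0 ⟧ _ _ (begin
    ⟦ g 0 ⟧ + count m (g ∘ suc) ≡⟨ count-snoc m g ⟩
    count m g + ⟦ g m ⟧         ≡⟨ cong (λ b → count m g + ⟦ b ⟧) (per 0) ⟩
    count m g + ⟦ g 0 ⟧         ≡⟨ +-comm (count m g) _ ⟩
    ⟦ g 0 ⟧ + count m g         ∎)
    where open ≡-Reasoning

periodic-multiple : ∀ {n g} → Periodic n g → ∀ t x → g (x + t * n) ≡ g x
periodic-multiple {n} {g} per zero    x = cong g (+-identityʳ x)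
periodic-multiple {n} {g} per (suc t) x = begin
  g (x + (n + t * n)) ≡⟨ cong g (x∙yz≈xz∙y x n (t * n)) ⟩
  g (x + t * n + n)   ≡⟨ per _ ⟩
  g (x + t * n)       ≡⟨ periodic-multiple per t x ⟩
  g x ∎
  where open ≡-Reasoning

periodic-mod : ∀ {n} {{_ : NonZero n}} {g} → Periodic n g → ∀ x → g (x % n) ≡ g x
periodic-mod {n} {g = g} per x = sym (trans (cong g (m≡m%n+[m/n]*n x n)) (periodic-multiple per (x / n) (x % n)))

count-positive : ∀ {n} {{_ : NonZero n}} {g} → Periodic n g → ∀ x → g x ≡ true → 1 ≤ count n g
count-positive {n} {g = g} per x gx =
  count-distinct n g (x % n ∷ []) ([] ∷ []) (m%n<n x n ∷ []) (trans (periodic-mod per x) gx ∷ [])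

two-in-window : ∀ {n g} → Periodic n g → ∀ p {o₁ o₂} → o₁ ≢ o₂ → o₁ < n → o₂ < n →
                g (p + o₁) ≡ true → g (p + o₂) ≡ true → 2 ≤ count n g
two-in-window {n} {g} per p o₁≢o₂ o₁<n o₂<n g₁ g₂ =
  subst (2 ≤_) (count-window n g per p)
    (count-distinct n (λ o → g (p + o)) _ ((o₁≢o₂ ∷ []) ∷ [] ∷ []) (o₁<n ∷ o₂<n ∷ []) (g₁ ∷ g₂ ∷ []))

three-in-window : ∀ {n g} → Periodic n g → ∀ p {o₁ o₂ o₃} → o₁ ≢ o₂ → o₁ ≢ o₃ → o₂ ≢ o₃ →
                  o₁ < n → o₂ < n → o₃ < n →
                  g (p + o₁) ≡ true → g (p + o₂) ≡ true → g (p + o₃) ≡ true → 3 ≤ count n g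
three-in-window {n} {g} per p ne₁₂ ne₁₃ ne₂₃ o₁<n o₂<n o₃<n g₁ g₂ g₃ =
  subst (3 ≤_) (count-window n g per p)
    (count-distinct n (λ o → g (p + o)) _ ((ne₁₂ ∷ ne₁₃ ∷ []) ∷ (ne₂₃ ∷ []) ∷ [] ∷ [])
      (o₁<n ∷ o₂<n ∷ o₃<n ∷ []) (g₁ ∷ g₂ ∷ g₃ ∷ []))

true≢false : true ≢ false
true≢false ()

not-true : ∀ {b} → not b ≡ true → b ≡ false
not-true {b} nb = trans (sym (not-involutive b)) (cong not nb)

∧-true : ∀ {a b} → a ∧ b ≡ true → a ≡ true × b ≡ true
∧-true {true} {true} _ = refl , refl

odd : ℕ → Bool
odd zero    = false
odd (suc x) = not (odd x)

odd-+ : ∀ m n → odd (m + n) ≡ odd m xor odd n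
odd-+ zero    n = refl
odd-+ (suc m) n = trans (cong not (odd-+ m n)) (not-distribˡ-xor (odd m) (odd n))

odd-* : ∀ m n → odd (m * n) ≡ odd m ∧ odd n
odd-* zero    n = refl
odd-* (suc m) n = trans (odd-+ n (m * n)) (trans (cong (odd n xor_) (odd-* m n)) (table (odd m) (odd n)))
  where
  table : ∀ a b → b xor (a ∧ b) ≡ not a ∧ b
  table false false = refl
  table false true  = refl
  table true  false = refl
  table true  true  = refl

odd-2+ : ∀ m → odd (2 + m) ≡ odd m
odd-2+ m = not-involutive (odd m)

odd-odd : ∀ a b → odd a ≡ true → odd b ≡ true → odd (a + b) ≡ false
odd-odd a b oa ob = trans (odd-+ a b) (cong₂ _xor_ oa ob)

odd-cancel : ∀ a {b} → odd (a + b) ≡ true → odd b ≡ true → odd a ≡ false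
odd-cancel a {b} oab ob = table (odd a) (odd b) (trans (sym (odd-+ a b)) oab) ob
  where
  table : ∀ x y → x xor y ≡ true → y ≡ true → x ≡ false
  table false true _  _ = refl
  table true  true () _

odd-mod : ∀ {n} {{_ : NonZero n}} → odd n ≡ false → ∀ y → odd (y % n) ≡ odd y
odd-mod {n} even-n y = sym (begin
  odd y                                  ≡⟨ cong odd (m≡m%n+[m/n]*n y n) ⟩
  odd (y % n + y / n * n)                ≡⟨ odd-+ (y % n) (y / n * n) ⟩
  odd (y % n) xor odd (y / n * n)        ≡⟨ cong (odd (y % n) xor_) (odd-* (y / n) n) ⟩
  odd (y % n) xor (odd (y / n) ∧ odd n)  ≡⟨ cong (λ b → odd (y % n) xor (odd (y / n) ∧ b)) even-n ⟩
  odd (y % n) xor (odd (y / n) ∧ false)  ≡⟨ cong (odd (y % n) xor_) (∧-zeroʳ (odd (y / n))) ⟩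
  odd (y % n) xor false                  ≡⟨ xor-identityʳ (odd (y % n)) ⟩
  odd (y % n)                            ∎)
  where open ≡-Reasoning

odd-+1 : ∀ x → odd (x + 1) ≡ not (odd x)
odd-+1 x = trans (odd-+ x 1) (xor-comm (odd x) true)

even⇒2∣ : ∀ n → odd n ≡ false → 2 ∣ n
even⇒2∣ zero          _ = divides 0 refl
even⇒2∣ (suc (suc n)) e = ∣m∣n⇒∣m+n (∣-refl {2}) (even⇒2∣ n (trans (sym (odd-2+ n)) e))

2∣⇒even : ∀ {n} → 2 ∣ n → odd n ≡ false
2∣⇒even (divides q refl) = trans (odd-* q 2) (∧-zeroʳ (odd q))

odd⇒2∤ : ∀ {n} → odd n ≡ true → ¬ 2 ∣ n
odd⇒2∤ o d = true≢false (trans (sym o) (2∣⇒even d))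

2∤⇒odd : ∀ k → ¬ 2 ∣ k → odd k ≡ true
2∤⇒odd k 2∤k with odd k in parity
... | true  = refl
... | false = ⊥-elim (2∤k (even⇒2∣ k parity))

Exceptional : ℕ → ℕ → Set
Exceptional n k = (2 ∣ n × ¬ 2 ∣ k) ⊎ ((¬ 2 ∣ n) × k ≡ 1) ⊎ (n ≡ 5 × k ≡ 2)

double-below : ∀ {n k} → 2 * k < n → k + k < n
double-below {n} {k} = subst (_< n) (cong (k +_) (+-identityʳ k))

at-most-2 : ∀ {x} → x ≤ 2 → x ≡ 0 ⊎ x ≡ 1 ⊎ x ≡ 2
at-most-2 z≤n             = inj₁ refl
at-most-2 (s≤s z≤n)       = inj₂ (inj₁ refl)
at-most-2 (s≤s (s≤s z≤n)) = inj₂ (inj₂ refl)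

odd-k≢1⇒3≤k : ∀ {k} → odd k ≡ true → k ≢ 1 → 3 ≤ k
odd-k≢1⇒3≤k {1}             _  k≢1 = ⊥-elim (k≢1 refl)
odd-k≢1⇒3≤k {suc (suc (suc k))} _ _ = s≤s (s≤s (s≤s z≤n))

even-k⇒2≤k : ∀ {k} → odd k ≡ false → 0 < k → 2 ≤ k
even-k⇒2≤k {suc (suc k)} _ _ = s≤s (s≤s z≤n)

k+4≤n : ∀ {n k} → odd k ≡ false → 0 < k → k + k < n → ¬ (n ≡ 5 × k ≡ 2) → k + 4 ≤ n
k+4≤n {n} {k} even-k 0<k k+k<n not-5-2 with m≤n⇒m<n∨m≡n (even-k⇒2≤k even-k 0<k)
... | inj₁ 2<k = ≤-trans (+-monoʳ-≤ k (s≤s 2<k)) (subst (_≤ n) (sym (+-suc k k)) k+k<n)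
... | inj₂ refl = ≤∧≢⇒< k+k<n (λ 5≡n → not-5-2 (sym 5≡n , refl))

even-between : ∀ {n k} → odd n ≡ false → k + k < n → n ≤ suc k + suc k → n ≡ suc k + suc k
even-between {n} {k} even-n k+k<n n≤ with m≤n⇒m<n∨m≡n n≤
... | inj₂ n≡ = n≡
... | inj₁ n< = ⊥-elim (true≢false (trans (sym odd-2k+1) (trans (cong odd 2k+1≡n) even-n)))
  where
  odd-2k+1 : odd (suc (k + k)) ≡ true
  odd-2k+1 = cong not (trans (odd-+ k k) (xor-same (odd k)))
  2k+1≡n : suc (k + k) ≡ n
  2k+1≡n = ≤-antisym k+k<n (s≤s⁻¹ (subst (n <_) (+-suc (suc k) k) n<))

step-mod : ∀ {n} {{_ : NonZero n}} {x} → x < n → (x + 1) % n ≡ x + 1 ⊎ (x + 1) % n ≡ 0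
step-mod {n} {x} x<n with m≤n⇒m<n∨m≡n x<n
... | inj₁ x+1<n = inj₁ (m<n⇒m%n≡m (subst (_< n) (+-comm 1 x) x+1<n))
... | inj₂ x+1≡n = inj₂ (trans (cong (_% n) (trans (+-comm x 1) x+1≡n)) (n%n≡0 n))

-- A vertex cover S of P(n,k) read as two n-periodic boolean sequences:
-- outer x says u_(x mod n) ∈ S, inner x says v_(x mod n) ∈ S.
record PeriodicCover (n k : ℕ) : Set where
  field
    outer inner    : ℕ → Bool
    outer-periodic : Periodic n outer
    inner-periodic : Periodic n inner
    rim   : ∀ x → outer x ∨ outer (suc x) ≡ true
    spoke : ∀ x → outer x ∨ inner x ≡ true
    hub   : ∀ x → inner x ∨ inner (x + k) ≡ true

module CoverAnalysis {n k : ℕ} {{_ : NonZero n}} (C : PeriodicCover n k) where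
  open PeriodicCover C

  rimDouble hubDouble spokeDouble : ℕ → Bool
  rimDouble x   = outer x ∧ outer (suc x)
  hubDouble x   = inner x ∧ inner (x + k)
  spokeDouble x = outer x ∧ inner x

  rimDouble-periodic : Periodic n rimDouble
  rimDouble-periodic x = cong₂ _∧_ (outer-periodic x) (outer-periodic (suc x))

  hubDouble-periodic : Periodic n hubDouble
  hubDouble-periodic x = cong₂ _∧_ (inner-periodic x) (trans (cong inner (xy∙z≈xz∙y x n k)) (inner-periodic (x + k)))

  spokeDouble-periodic : Periodic n spokeDouble
  spokeDouble-periodic x = cong₂ _∧_ (outer-periodic x) (inner-periodic x)

  #outer #inner #rim #hub #spoke : ℕ
  #outer = count n outer
  #inner = count n inner
  #rim   = count n rimDouble
  #hub   = count n hubDouble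
  #spoke = count n spokeDouble

  rim-count : #outer + #outer ≡ n + #rim
  rim-count = trans (cong (#outer +_) (sym (count-window n outer outer-periodic 1)))
                    (count-∨ n outer (outer ∘ suc) rim)

  hub-count : #inner + #inner ≡ n + #hub
  hub-count = begin
    #inner + #inner                        ≡⟨ cong (#inner +_) (count-window n inner inner-periodic k) ⟨
    #inner + count n (λ x → inner (k + x)) ≡⟨ cong (#inner +_) (count-cong n (λ x → cong inner (+-comm k x))) ⟩
    #inner + count n (λ x → inner (x + k)) ≡⟨ count-∨ n inner (λ x → inner (x + k)) hub ⟩
    n + #hub                               ∎
    where open ≡-Reasoning

  spoke-count : #outer + #inner ≡ n + #spoke
  spoke-count = count-∨ n outer inner spoke

  doubles-balance : #rim + #hub ≡ #spoke + #spoke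
  doubles-balance = +-cancelˡ-≡ (n + n) _ _ (begin
    n + n + (#rim + #hub)                   ≡⟨ interchange n n #rim #hub ⟩
    (n + #rim) + (n + #hub)                 ≡⟨ cong₂ _+_ rim-count hub-count ⟨
    (#outer + #outer) + (#inner + #inner)   ≡⟨ interchange #outer #outer #inner #inner ⟩
    (#outer + #inner) + (#outer + #inner)   ≡⟨ cong₂ _+_ spoke-count spoke-count ⟩
    (n + #spoke) + (n + #spoke)             ≡⟨ interchange n #spoke n #spoke ⟩
    n + n + (#spoke + #spoke)               ∎)
    where open ≡-Reasoning

  odd-#rim : odd #rim ≡ odd n
  odd-#rim = table (odd n) (odd #rim) (begin
    odd n xor odd #rim         ≡⟨ odd-+ n #rim ⟨
    odd (n + #rim)             ≡⟨ cong odd rim-count ⟨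
    odd (#outer + #outer)      ≡⟨ odd-+ #outer #outer ⟩
    odd #outer xor odd #outer  ≡⟨ xor-same (odd #outer) ⟩
    false                      ∎)
    where
    open ≡-Reasoning
    table : ∀ x y → x xor y ≡ false → y ≡ x
    table false false _ = refl
    table true  true  _ = refl

  rim+hub≤2 : #spoke ≤ 1 → #rim + #hub ≤ 2
  rim+hub≤2 few = subst (_≤ 2) (sym doubles-balance) (+-mono-≤ few few)

  rim-step : ∀ x → rimDouble x ≡ false → outer (suc x) ≡ not (outer x)
  rim-step x single with outer x | outer (suc x) | rim x
  ... | true  | false | _ = refl
  ... | false | true  | _ = refl

  alternation : ∀ i j → (∀ m → m < j → rimDouble (i + m) ≡ false) → outer (i + j) ≡ outer i xor odd j
  alternation i zero    _    = trans (cong outer (+-identityʳ i)) (sym (xor-identityʳ (outer i)))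
  alternation i (suc j) free = begin
    outer (i + suc j)          ≡⟨ cong outer (+-suc i j) ⟩
    outer (suc (i + j))        ≡⟨ rim-step (i + j) (free j (n<1+n j)) ⟩
    not (outer (i + j))        ≡⟨ cong not (alternation i j (λ m m<j → free m (m<n⇒m<1+n m<j))) ⟩
    not (outer i xor odd j)    ≡⟨ not-distribʳ-xor (outer i) (odd j) ⟩
    outer i xor odd (suc j)    ∎
    where open ≡-Reasoning

  Alternating : ℕ → ℕ → Set
  Alternating p j = ∀ m → 0 < m → m < j → rimDouble (p + m) ≡ false

  profile : ∀ {p j} → rimDouble p ≡ true → Alternating p j → ∀ o → 0 < o → o ≤ j → outer (p + o) ≡ odd o
  profile {p} {j} double alt (suc o) _ o<j = begin
    outer (p + suc o)          ≡⟨ cong outer (+-suc p o) ⟩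
    outer (suc p + o)          ≡⟨ alternation (suc p) o free ⟩
    outer (suc p) xor odd o    ≡⟨ cong (_xor odd o) (proj₂ (∧-true {outer p} double)) ⟩
    odd (suc o)                ∎
    where
    open ≡-Reasoning
    free : ∀ m → m < o → rimDouble (suc p + m) ≡ false
    free m m<o = subst (λ x → rimDouble x ≡ false) (+-suc p m) (alt (suc m) (s≤s z≤n) (<-≤-trans (s≤s m<o) o<j))

  inner-at-gap : ∀ {x} → outer x ≡ false → inner x ≡ true
  inner-at-gap {x} gap = subst (λ b → b ∨ inner x ≡ true) gap (spoke x)

  hubDouble-from-gaps : ∀ x → outer x ≡ false → outer (x + k) ≡ false → hubDouble x ≡ true
  hubDouble-from-gaps x gap₁ gap₂ = cong₂ _∧_ (inner-at-gap gap₁) (inner-at-gap gap₂)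

  hubDouble-after-spoke : ∀ {x} → spokeDouble x ≡ true → outer (x + k) ≡ false → hubDouble x ≡ true
  hubDouble-after-spoke {x} double gap = cong₂ _∧_ (proj₂ (∧-true {outer x} double)) (inner-at-gap gap)

  hubDouble-before-spoke : ∀ {x} → outer x ≡ false → spokeDouble (x + k) ≡ true → hubDouble x ≡ true
  hubDouble-before-spoke {x} gap double = cong₂ _∧_ (inner-at-gap gap) (proj₂ (∧-true {outer (x + k)} double))

  hubDouble-in-run : ∀ {p j o} → rimDouble p ≡ true → Alternating p j → 0 < o → o + k ≤ j →
                     odd o ≡ false → odd (o + k) ≡ false → hubDouble (p + o) ≡ true
  hubDouble-in-run {p} {j} {o} double alt 0<o o+k≤j even-o even-o+k = hubDouble-from-gaps (p + o)
    (trans (profile double alt o 0<o (≤-trans (m≤m+n o k) o+k≤j)) even-o)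
    (trans (cong outer (+-assoc p o k)) (trans (profile double alt (o + k) (<-≤-trans 0<o (m≤m+n o k)) o+k≤j) even-o+k))

  false-if-absent : ∀ {g} → Periodic n g → count n g ≡ 0 → ∀ x → g x ≡ false
  false-if-absent per none x = ¬-not (λ gx → <⇒≢ (count-positive per x gx) (sym none))

  at-offset-0 : ∀ {g : ℕ → Bool} {p} → g p ≡ true → g (p + 0) ≡ true
  at-offset-0 {g} {p} gp = subst (λ x → g x ≡ true) (sym (+-identityʳ p)) gp

  first-rimDouble : 1 ≤ #rim → ∃ λ p → rimDouble p ≡ true
  first-rimDouble pos with count-witness n rimDouble pos
  ... | p , _ , double = p , double

  second-rimDouble : #rim ≡ 2 → ∀ {p} → rimDouble p ≡ true → ∃ λ g → 0 < g × g < n × rimDouble (p + g) ≡ true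
  second-rimDouble two {p} double = other (count-witness n (after without 0) one-more)
    where
    after : ℕ → Bool
    after o = rimDouble (p + o)
    one-more : 1 ≤ count n (after without 0)
    one-more = s≤s⁻¹ (≤-reflexive (trans (sym (trans (count-window n rimDouble rimDouble-periodic p) two))
      (count-without n after 0 (>-nonZero⁻¹ n) (at-offset-0 {rimDouble} double))))
    other : (∃ λ g → g < n × (after without 0) g ≡ true) → ∃ λ g → 0 < g × g < n × rimDouble (p + g) ≡ true
    other (zero  , _   , excluded) = ⊥-elim (true≢false (trans (sym excluded) (∧-zeroʳ (rimDouble (p + 0)))))
    other (suc g , g<n , double′)  = suc g , s≤s z≤n , g<n , proj₁ (∧-true {rimDouble (p + suc g)} double′)

  spoke-after : 1 ≤ #spoke → ∀ p → ∃ λ o → 0 < o × o ≤ n × spokeDouble (p + o) ≡ true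
  spoke-after pos p with count-witness n (λ o → spokeDouble (p + o))
                           (subst (1 ≤_) (sym (count-window n spokeDouble spokeDouble-periodic p)) pos)
  ... | zero  , _   , double = n , >-nonZero⁻¹ n , ≤-refl ,
                                   trans (spokeDouble-periodic p) (subst (λ x → spokeDouble x ≡ true) (+-identityʳ p) double)
  ... | suc o , o<n , double = suc o , s≤s z≤n , <⇒≤ o<n , double

  sole-rimDouble : #rim ≤ 1 → ∀ {p} → rimDouble p ≡ true → Alternating p n
  sole-rimDouble few {p} double m 0<m m<n = ¬-not λ double′ →
    ≤⇒≯ few (two-in-window rimDouble-periodic p (<⇒≢ 0<m) (<-trans 0<m m<n) m<n (at-offset-0 {rimDouble} double) double′)

  two-rimDoubles : #rim ≤ 2 → ∀ {p g} → 0 < g → g < n → rimDouble p ≡ true → rimDouble (p + g) ≡ true →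
                   Alternating p g × Alternating (p + g) (n ∸ g)
  two-rimDoubles few {p} {g} 0<g g<n double₁ double₂ = first , second
    where
    three : ∀ {m} → 0 < m → g ≢ m → m < n → rimDouble (p + m) ≡ true → ⊥
    three 0<m g≢m m<n double₃ = ≤⇒≯ few (three-in-window rimDouble-periodic p
      (<⇒≢ 0<g) (<⇒≢ 0<m) g≢m (<-trans 0<g g<n) g<n m<n (at-offset-0 {rimDouble} double₁) double₂ double₃)
    first : Alternating p g
    first m 0<m m<g = ¬-not (three 0<m (>⇒≢ m<g) (<-trans m<g g<n))
    second : Alternating (p + g) (n ∸ g)
    second m 0<m m<n-g = ¬-not λ double₃ → three (<-≤-trans 0<m (m≤n+m m g)) (<⇒≢ (m<m+n g 0<m))
      (subst (g + m <_) (m+[n∸m]≡n (<⇒≤ g<n)) (+-monoʳ-< g m<n-g))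
      (subst (λ x → rimDouble x ≡ true) (+-assoc p g m) double₃)

  -- Even k and no doubly covered rim edge: outer alternates, so every missing outer
  -- vertex starts a doubly covered hub edge, and half of the outer vertices are missing.
  no-rimDouble-case : #rim ≡ 0 → odd k ≡ false → 4 < n → 3 ≤ #hub
  no-rimDouble-case none even-k 4<n =
    ≤-trans (subst (3 ≤_) (sym #missing≡#outer) 3≤#outer) (count-mono n hub-at-missing)
    where
    hub-at-missing : ∀ x → not (outer x) ≡ true → hubDouble x ≡ true
    hub-at-missing x missing = hubDouble-from-gaps x (not-true missing)
      (trans (alternation x k (λ m _ → false-if-absent rimDouble-periodic none (x + m)))
             (cong₂ _xor_ (not-true missing) even-k))
    #outer+#outer≡n : #outer + #outer ≡ n
    #outer+#outer≡n = trans rim-count (trans (cong (n +_) none) (+-identityʳ n))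
    #missing≡#outer : count n (not ∘ outer) ≡ #outer
    #missing≡#outer = +-cancelˡ-≡ #outer _ _ (trans (count-complement n outer) (sym #outer+#outer≡n))
    3≤#outer : 3 ≤ #outer
    3≤#outer = ≮⇒≥ λ #outer<3 →
      <⇒≱ 4<n (subst (_≤ 4) #outer+#outer≡n (+-mono-≤ (s≤s⁻¹ #outer<3) (s≤s⁻¹ #outer<3)))

  -- Even k, no doubly covered hub edge, doubly covered rim edges at p and p + g only:
  -- a stretch of k + 2 after either would force a doubly covered hub edge, so n ≤ 2k + 2.
  short-gaps : #rim ≤ 2 → #hub ≡ 0 → odd k ≡ false → ∀ {p g} → 0 < g → g < n →
               rimDouble p ≡ true → rimDouble (p + g) ≡ true → n ≤ suc k + suc k
  short-gaps few none even-k {p} {g} 0<g g<n double₁ double₂ = begin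
    n              ≡⟨ m+[n∸m]≡n (<⇒≤ g<n) ⟨
    g + (n ∸ g)    ≤⟨ +-mono-≤ (short double₁ alt₁) (short double₂ alt₂) ⟩
    suc k + suc k  ∎
    where
    open ≤-Reasoning
    alt₁ : Alternating p g
    alt₁ = proj₁ (two-rimDoubles few 0<g g<n double₁ double₂)
    alt₂ : Alternating (p + g) (n ∸ g)
    alt₂ = proj₂ (two-rimDoubles few 0<g g<n double₁ double₂)
    short : ∀ {q j} → rimDouble q ≡ true → Alternating q j → j ≤ suc k
    short {q} double alt = ≮⇒≥ λ k+2≤j → true≢false (trans
      (sym (hubDouble-in-run double alt (s≤s z≤n) k+2≤j refl (trans (odd-2+ k) even-k)))
      (false-if-absent hubDouble-periodic none (q + 2)))

  -- Without doubly covered hub edges, inner alternates along hub steps ...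
  hub-alternation : #hub ≡ 0 → ∀ j x → inner (x + j * k) ≡ inner x xor odd j
  hub-alternation none zero    x = trans (cong inner (+-identityʳ x)) (sym (xor-identityʳ (inner x)))
  hub-alternation none (suc j) x = begin
    inner (x + (k + j * k))  ≡⟨ cong inner (x∙yz≈xz∙y x k (j * k)) ⟩
    inner (x + j * k + k)    ≡⟨ hub-step (x + j * k) ⟩
    not (inner (x + j * k))  ≡⟨ cong not (hub-alternation none j x) ⟩
    not (inner x xor odd j)  ≡⟨ not-distribʳ-xor (inner x) (odd j) ⟩
    inner x xor odd (suc j)  ∎
    where
    open ≡-Reasoning
    hub-step : ∀ y → inner (y + k) ≡ not (inner y)
    hub-step y with inner y | inner (y + k) | hub y | false-if-absent hubDouble-periodic none y
    ... | true  | false | _ | _ = refl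
    ... | false | true  | _ | _ = refl

  -- ... which is impossible when the hub closes up after an odd number k + 1 of steps.
  odd-hub-cycle : #hub ≡ 0 → odd k ≡ false → n ≡ suc k + suc k → ⊥
  odd-hub-cycle none even-k n≡ with even⇒2∣ k even-k
  ... | divides t k≡t*2 = not-¬ {inner 0} refl (trans (sym around) flipped)
    where
    open ≡-Reasoning
    identity : ∀ t → suc (t * 2) * (t * 2) ≡ t * (suc (t * 2) + suc (t * 2))
    identity = solve-∀
    k+1-steps : suc k * k ≡ t * n
    k+1-steps = begin
      suc k * k                           ≡⟨ cong (λ m → suc m * m) k≡t*2 ⟩
      suc (t * 2) * (t * 2)               ≡⟨ identity t ⟩
      t * (suc (t * 2) + suc (t * 2))     ≡⟨ cong (λ m → t * (suc m + suc m)) k≡t*2 ⟨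
      t * (suc k + suc k)                 ≡⟨ cong (t *_) n≡ ⟨
      t * n                               ∎
    around : inner (0 + suc k * k) ≡ inner 0
    around = trans (cong (λ m → inner (0 + m)) k+1-steps) (periodic-multiple inner-periodic t 0)
    flipped : inner (0 + suc k * k) ≡ not (inner 0)
    flipped = trans (hub-alternation none (suc k) 0)
                    (trans (cong (λ b → inner 0 xor not b) even-k) (xor-comm (inner 0) true))

  -- Even n and even k: there are 0 or 2 doubly covered rim edges, and both are impossible.
  even-even-case : #spoke ≤ 1 → odd n ≡ false → odd k ≡ false → 0 < k → k + k < n → ⊥
  even-even-case few even-n even-k 0<k k+k<n with at-most-2 (≤-trans (m≤m+n #rim #hub) (rim+hub≤2 few))
  ... | inj₁ none = ≤⇒≯ (≤-trans (m≤n+m #hub #rim) (rim+hub≤2 few)) (no-rimDouble-case none even-k 4<n)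
    where
    4<n : 4 < n
    4<n = ≤-<-trans (+-mono-≤ (even-k⇒2≤k even-k 0<k) (even-k⇒2≤k even-k 0<k)) k+k<n
  ... | inj₂ (inj₁ one) = true≢false (trans (cong odd (sym one)) (trans odd-#rim even-n))
  ... | inj₂ (inj₂ two) with first-rimDouble (subst (1 ≤_) (sym two) (s≤s z≤n))
  ...   | p , double with second-rimDouble two double
  ...     | g , 0<g , g<n , double′ = odd-hub-cycle no-hub even-k
              (even-between even-n k+k<n (short-gaps (≤-reflexive two) no-hub even-k 0<g g<n double double′))
    where
    no-hub : #hub ≡ 0
    no-hub = n≤0⇒n≡0 (+-cancelˡ-≤ 2 _ _ (subst (λ r → r + #hub ≤ 2) two (rim+hub≤2 few)))

  odd-counts : #spoke ≤ 1 → odd n ≡ true → #rim ≡ 1 × #hub ≤ 1 × 1 ≤ #spoke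
  odd-counts few odd-n with at-most-2 (≤-trans (m≤m+n #rim #hub) (rim+hub≤2 few))
  ... | inj₁ none       = ⊥-elim (true≢false (trans (sym odd-n) (trans (sym odd-#rim) (cong odd none))))
  ... | inj₂ (inj₂ two) = ⊥-elim (true≢false (trans (sym odd-n) (trans (sym odd-#rim) (cong odd two))))
  ... | inj₂ (inj₁ one) = one , #hub≤1 , 1≤#spoke
    where
    #hub≤1 : #hub ≤ 1
    #hub≤1 = +-cancelˡ-≤ 1 _ _ (subst (λ r → r + #hub ≤ 2) one (rim+hub≤2 few))
    1≤#spoke : 1 ≤ #spoke
    1≤#spoke = ≮⇒≥ λ #spoke<1 → 1+n≢0 (trans (cong (_+ #hub) (sym one))
      (trans doubles-balance (cong (λ s → s + s) (n<1⇒n≡0 #spoke<1))))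

  -- Odd n, even k: with one doubly covered rim edge (at p), the hub edges at offsets
  -- 2 and 4 after p are doubly covered.
  odd-even-case : #hub ≤ 1 → ∀ {p} → rimDouble p ≡ true → Alternating p n →
                  odd k ≡ false → 0 < k → k + 4 ≤ n → ⊥
  odd-even-case few {p} double alt even-k 0<k k+4≤n = ≤⇒≯ few
    (two-in-window hubDouble-periodic p {2} {4} (λ ()) (<-trans (s≤s (s≤s (s≤s z≤n))) 4<n) 4<n
      (hubDouble-in-run double alt (s≤s z≤n) (≤-trans (+-monoˡ-≤ k (s≤s (s≤s z≤n))) 4+k≤n)
         refl (trans (odd-2+ k) even-k))
      (hubDouble-in-run double alt (s≤s z≤n) 4+k≤n
         refl (trans (odd-2+ (2 + k)) (trans (odd-2+ k) even-k))))
    where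
    4+k≤n : 4 + k ≤ n
    4+k≤n = subst (_≤ n) (+-comm k 4) k+4≤n
    4<n : 4 < n
    4<n = <-≤-trans (m<m+n 4 0<k) 4+k≤n

  -- Odd n, odd k ≥ 2, one doubly covered rim edge (at p): n - 1 and k - 1 are even and
  -- p + (n - 1) + k ≡ p + (k - 1) (mod n), so the hub edge at offset n - 1 is doubly covered.
  hubDouble-at-end : ∀ {p} → rimDouble p ≡ true → Alternating p n → odd n ≡ true → odd k ≡ true →
                     2 ≤ k → k < n → hubDouble (p + pred n) ≡ true
  hubDouble-at-end {p} double alt odd-n odd-k 2≤k k<n = hubDouble-from-gaps (p + pred n)
    (trans (profile double alt (pred n) 0<n′ pred[n]≤n) (not-true (subst (λ m → odd m ≡ true) (sym (suc-pred n)) odd-n)))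
    (begin
      outer (p + pred n + k)     ≡⟨ cong outer wrap ⟩
      outer (p + (k ∸ 1) + n)    ≡⟨ outer-periodic (p + (k ∸ 1)) ⟩
      outer (p + (k ∸ 1))        ≡⟨ profile double alt (k ∸ 1) (pred-mono-≤ 2≤k) (≤-trans (m∸n≤m k 1) (<⇒≤ k<n)) ⟩
      odd (k ∸ 1)                ≡⟨ not-true (subst (λ m → odd m ≡ true) (sym k′+1≡k) odd-k) ⟩
      false                      ∎)
    where
    open ≡-Reasoning
    k′+1≡k : suc (k ∸ 1) ≡ k
    k′+1≡k = m+[n∸m]≡n (<-≤-trans (s≤s z≤n) 2≤k)
    0<n′ : 0 < pred n
    0<n′ = <⇒≤pred (<-trans 2≤k k<n)
    swap : ∀ p a b → p + a + suc b ≡ p + b + suc a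
    swap = solve-∀
    wrap : p + pred n + k ≡ p + (k ∸ 1) + n
    wrap = begin
      p + pred n + k              ≡⟨ cong (p + pred n +_) k′+1≡k ⟨
      p + pred n + suc (k ∸ 1)    ≡⟨ swap p (pred n) (k ∸ 1) ⟩
      p + (k ∸ 1) + suc (pred n)  ≡⟨ cong (p + (k ∸ 1) +_) (suc-pred n) ⟩
      p + (k ∸ 1) + n             ∎

  -- Odd k ≥ 2, one doubly covered rim edge (at p), a doubly covered spoke at offset
  -- o ∈ (0, n]: o is odd, so if o + k < n the hub edge forward from the spoke is doubly
  -- covered, and otherwise the one backward from it, starting at the even offset o - k.
  hubDouble-near-spoke : ∀ {p} → rimDouble p ≡ true → Alternating p n → odd k ≡ true → 2 ≤ k → k + k < n →
                         ∀ {o} → 0 < o → o ≤ n → spokeDouble (p + o) ≡ true →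
                         ∃ λ e → e < pred n × hubDouble (p + e) ≡ true
  hubDouble-near-spoke {p} double alt odd-k 2≤k k+k<n {o} 0<o o≤n spoke-o = by-size (o + k <? n)
    where
    odd-o : odd o ≡ true
    odd-o = trans (sym (profile double alt o 0<o o≤n)) (proj₁ (∧-true {outer (p + o)} spoke-o))
    by-size : Dec (o + k < n) → ∃ λ e → e < pred n × hubDouble (p + e) ≡ true
    by-size (yes o+k<n) = o , o<n′ , hubDouble-after-spoke spoke-o (trans (cong outer (+-assoc p o k))
        (trans (profile double alt (o + k) (<-≤-trans 0<o (m≤m+n o k)) (<⇒≤ o+k<n)) (odd-odd o k odd-o odd-k)))
      where
      o<n′ : o < pred n
      o<n′ = pred-mono-≤ (≤-trans (subst (_≤ o + k) (+-comm o 2) (+-monoʳ-≤ o 2≤k)) (<⇒≤ o+k<n))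
    by-size (no o+k≮n) = o ∸ k , e<n′ , hubDouble-before-spoke gap (subst (λ x → spokeDouble x ≡ true) (sym p+e+k≡p+o) spoke-o)
      where
      k<o : k < o
      k<o = +-cancelʳ-< k k o (<-≤-trans k+k<n (≮⇒≥ o+k≮n))
      e+k≡o : o ∸ k + k ≡ o
      e+k≡o = m∸n+n≡m (<⇒≤ k<o)
      p+e+k≡p+o : p + (o ∸ k) + k ≡ p + o
      p+e+k≡p+o = trans (+-assoc p (o ∸ k) k) (cong (p +_) e+k≡o)
      gap : outer (p + (o ∸ k)) ≡ false
      gap = trans (profile double alt (o ∸ k) (m<n⇒0<n∸m k<o) (≤-trans (m∸n≤m o k) o≤n))
                  (odd-cancel (o ∸ k) (subst (λ m → odd m ≡ true) (sym e+k≡o) odd-o) odd-k)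
      e<n′ : o ∸ k < pred n
      e<n′ = pred-mono-≤ (≤-trans (subst (_≤ o ∸ k + k) (+-comm (o ∸ k) 2) (+-monoʳ-≤ (o ∸ k) 2≤k))
                                  (subst (_≤ n) (sym e+k≡o) o≤n))

  odd-odd-case : #hub ≤ 1 → ∀ {p} → rimDouble p ≡ true → Alternating p n → odd n ≡ true →
                 odd k ≡ true → 3 ≤ k → k + k < n → ∀ {o} → 0 < o → o ≤ n → spokeDouble (p + o) ≡ true → ⊥
  odd-odd-case few {p} double alt odd-n odd-k 3≤k k+k<n 0<o o≤n spoke-o =
    two-hubDoubles (hubDouble-near-spoke double alt odd-k (<⇒≤ 3≤k) k+k<n 0<o o≤n spoke-o)
    where
    k<n : k < n
    k<n = <-≤-trans (m<m+n k (<-trans (s≤s z≤n) 3≤k)) (<⇒≤ k+k<n)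
    n′<n : pred n < n
    n′<n = subst (pred n <_) (suc-pred n) (n<1+n (pred n))
    two-hubDoubles : (∃ λ e → e < pred n × hubDouble (p + e) ≡ true) → ⊥
    two-hubDoubles (e , e<n′ , hub-e) = ≤⇒≯ few (two-in-window hubDouble-periodic p (<⇒≢ e<n′) (<-trans e<n′ n′<n)
      n′<n hub-e (hubDouble-at-end double alt odd-n odd-k (<⇒≤ 3≤k) k<n))

  odd-case : #spoke ≤ 1 → odd n ≡ true → k ≢ 1 → ¬ (n ≡ 5 × k ≡ 2) → 0 < k → k + k < n → ⊥
  odd-case few odd-n k≢1 not-5-2 0<k k+k<n with odd-counts few odd-n
  ... | #rim≡1 , #hub≤1 , 1≤#spoke with first-rimDouble (≤-reflexive (sym #rim≡1))
  ...   | p , double = by-parity-of-k (odd k) refl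
    where
    alt : Alternating p n
    alt = sole-rimDouble (≤-reflexive #rim≡1) double
    by-parity-of-k : ∀ b → odd k ≡ b → ⊥
    by-parity-of-k false even-k = odd-even-case #hub≤1 double alt even-k 0<k (k+4≤n even-k 0<k k+k<n not-5-2)
    by-parity-of-k true  odd-k with spoke-after 1≤#spoke p
    ... | o , 0<o , o≤n , spoke-o =
      odd-odd-case #hub≤1 double alt odd-n odd-k (odd-k≢1⇒3≤k odd-k k≢1) k+k<n 0<o o≤n spoke-o

  few-spokeDoubles : 0 < k → k + k < n → #spoke ≤ 1 → Exceptional n k
  few-spokeDoubles 0<k k+k<n few with odd n in parity-n | odd k in parity-k
  ... | false | true  = inj₁ (even⇒2∣ n parity-n , odd⇒2∤ parity-k)
  ... | false | false = ⊥-elim (even-even-case few parity-n parity-k 0<k k+k<n)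
  ... | true  | _ with k ≟ 1 | (n ≟ 5) ×-dec (k ≟ 2)
  ...   | yes k≡1 | _          = inj₂ (inj₁ (odd⇒2∤ parity-n , k≡1))
  ...   | no _    | yes n,k≡5,2 = inj₂ (inj₂ n,k≡5,2)
  ...   | no k≢1  | no not-5-2  = ⊥-elim (odd-case few parity-n k≢1 not-5-2 0<k k+k<n)

size-cons : ∀ {m} b (V : Vec Bool m) → size (b ∷ V) ≡ ⟦ b ⟧ + size V
size-cons true  V = refl
size-cons false V = refl

size-block : ∀ {m} (V : Vec Bool m) (h : ℕ → Bool) → (∀ j → lookup V j ≡ h (toℕ j)) → size V ≡ count m h
size-block []      h eq = refl
size-block (b ∷ V) h eq = trans (size-cons b V) (cong₂ _+_ (cong ⟦_⟧ (eq zero)) (size-block V (h ∘ suc) (eq ∘ suc)))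

size-blocks : ∀ m {m′} (V : Vec Bool (m + m′)) (g h : ℕ → Bool) →
              (∀ i → lookup V (i ↑ˡ m′) ≡ g (toℕ i)) → (∀ j → lookup V (m ↑ʳ j) ≡ h (toℕ j)) →
              size V ≡ count m g + count m′ h
size-blocks zero    V       g h _   eq₂ = size-block V h eq₂
size-blocks (suc m) {m′} (b ∷ V) g h eq₁ eq₂ = begin
  size (b ∷ V)                                     ≡⟨ size-cons b V ⟩
  ⟦ b ⟧ + size V                                 ≡⟨ cong₂ _+_ (cong ⟦_⟧ (eq₁ zero)) (size-blocks m V (g ∘ suc) h (eq₁ ∘ suc) eq₂) ⟩
  ⟦ g 0 ⟧ + (count m (g ∘ suc) + count m′ h)    ≡⟨ +-assoc ⟦ g 0 ⟧ _ _ ⟨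
  count (suc m) g + count m′ h                  ∎
  where open ≡-Reasoning

module Petersen (n k : ℕ) {{_ : NonZero n}} where

  CoveredAt : Subset (n + n) → Fin n → Set
  CoveredAt S i = ((u i ∈ S) ⊎ (u (toℕ i ⊕[ n ] 1) ∈ S))
                × ((u i ∈ S) ⊎ (v i ∈ S))
                × ((v i ∈ S) ⊎ (v (toℕ i ⊕[ n ] k) ∈ S))

  cover⇒coveredAt : ∀ {S} → IsVertexCover (petersenEdges n k) S → ∀ i → CoveredAt S i
  cover⇒coveredAt cov i with All.lookup (map⁻ (concat⁻ cov)) (∈-allFin i)
  ... | rim ∷ spoke ∷ hub ∷ [] = rim , spoke , hub

  coveredAt⇒cover : ∀ {S} → (∀ i → CoveredAt S i) → IsVertexCover (petersenEdges n k) S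
  coveredAt⇒cover {S} covered = concat⁺ (map⁺ (tabulate⁺ edges))
    where
    Covers : Fin (n + n) × Fin (n + n) → Set
    Covers (a , b) = (a ∈ S) ⊎ (b ∈ S)
    edges : ∀ i → All Covers ((u i , u (toℕ i ⊕[ n ] 1)) ∷ (u i , v i) ∷ (v i , v (toℕ i ⊕[ n ] k)) ∷ [])
    edges i with covered i
    ... | rim , spoke , hub = rim ∷ spoke ∷ hub ∷ []

  mod-cong : ∀ {x y} → x % n ≡ y % n → x mod n ≡ y mod n
  mod-cong eq = toℕ-injective (trans (toℕ-fromℕ< _) (trans eq (sym (toℕ-fromℕ< _))))

  toℕ-mod : ∀ (i : Fin n) → toℕ i mod n ≡ i
  toℕ-mod i = toℕ-injective (trans (toℕ-fromℕ< _) (m<n⇒m%n≡m (toℕ<n i)))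

  shift-mod : ∀ x c → toℕ (x mod n) ⊕[ n ] c ≡ (x + c) mod n
  shift-mod x c = mod-cong (begin
    (toℕ (x mod n) + c) % n             ≡⟨ cong (λ y → (y + c) % n) (toℕ-fromℕ< _) ⟩
    (x % n + c) % n                     ≡⟨ %-distribˡ-+ (x % n) c n ⟩
    (x % n % n + c % n) % n             ≡⟨ cong (λ y → (y + c % n) % n) (m%n%n≡m%n x n) ⟩
    (x % n + c % n) % n                 ≡⟨ %-distribˡ-+ x c n ⟨
    (x + c) % n                         ∎)
    where open ≡-Reasoning

  covered⇒∨ : ∀ {S : Subset (n + n)} {a b} → (a ∈ S) ⊎ (b ∈ S) → lookup S a ∨ lookup S b ≡ true
  covered⇒∨ {S} {a} {b} (inj₁ a∈S) = subst (λ x → x ∨ lookup S b ≡ true) (sym ([]=⇒lookup a∈S)) refl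
  covered⇒∨ {S} {a} {b} (inj₂ b∈S) = trans (cong (lookup S a ∨_) ([]=⇒lookup b∈S)) (∨-zeroʳ (lookup S a))

  ∨⇒covered : ∀ {S : Subset (n + n)} {a b} → lookup S a ∨ lookup S b ≡ true → (a ∈ S) ⊎ (b ∈ S)
  ∨⇒covered {S} {a} {b} covered with lookup S a in a∈S
  ... | true  = inj₁ (lookup⇒[]= a S a∈S)
  ... | false = inj₂ (lookup⇒[]= b S covered)

  outerOf innerOf : Subset (n + n) → ℕ → Bool
  outerOf S x = lookup S (u (x mod n))
  innerOf S x = lookup S (v (x mod n))

  toPeriodicCover : ∀ S → IsVertexCover (petersenEdges n k) S → PeriodicCover n k
  toPeriodicCover S cov = record
    { outer          = outerOf S
    ; inner          = innerOf S
    ; outer-periodic = λ x → cong (λ i → lookup S (u i)) (mod-cong ([m+n]%n≡m%n x n))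
    ; inner-periodic = λ x → cong (λ i → lookup S (v i)) (mod-cong ([m+n]%n≡m%n x n))
    ; rim   = λ x → subst (λ i → outerOf S x ∨ lookup S (u i) ≡ true)
                      (trans (shift-mod x 1) (cong (_mod n) (+-comm x 1)))
                      (covered⇒∨ (proj₁ (covered x)))
    ; spoke = λ x → covered⇒∨ (proj₁ (proj₂ (covered x)))
    ; hub   = λ x → subst (λ i → innerOf S x ∨ lookup S (v i) ≡ true) (shift-mod x k)
                      (covered⇒∨ (proj₂ (proj₂ (covered x))))
    }
    where
    covered : ∀ x → CoveredAt S (x mod n)
    covered x = cover⇒coveredAt cov (x mod n)

  size-rings : ∀ S → size S ≡ count n (outerOf S) + count n (innerOf S)
  size-rings S = size-blocks n S (outerOf S) (innerOf S)
    (λ i → cong (λ j → lookup S (u j)) (sym (toℕ-mod i)))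
    (λ j → cong (λ i → lookup S (v i)) (sym (toℕ-mod j)))

  module FromSequences (f g : ℕ → Bool) where
    block : (ℕ → Bool) → Vec Bool n
    block h = tabulate (h ∘ toℕ)

    S : Subset (n + n)
    S = block f ++ block g

    lookup-outer : ∀ (i : Fin n) → lookup S (u i) ≡ f (toℕ i)
    lookup-outer i = trans (lookup-++ˡ (block f) (block g) i) (lookup∘tabulate (f ∘ toℕ) i)

    lookup-inner : ∀ (i : Fin n) → lookup S (v i) ≡ g (toℕ i)
    lookup-inner i = trans (lookup-++ʳ (block f) (block g) i) (lookup∘tabulate (g ∘ toℕ) i)

    size-S : size S ≡ count n f + count n g
    size-S = size-blocks n S f g lookup-outer lookup-inner

    S-cover : (∀ x → x < n → f x ∨ f ((x + 1) % n) ≡ true) → (∀ x → x < n → f x ∨ g x ≡ true) →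
              (∀ x → x < n → g x ∨ g ((x + k) % n) ≡ true) → IsVertexCover (petersenEdges n k) S
    S-cover rim spoke hub = coveredAt⇒cover λ i → ∨⇒covered {S} (rim-at i) , ∨⇒covered {S} (spoke-at i) , ∨⇒covered {S} (hub-at i)
      where
      step : ∀ (w : Fin n → Fin (n + n)) (h : ℕ → Bool) → (∀ j → lookup S (w j) ≡ h (toℕ j)) →
             ∀ (i : Fin n) c → lookup S (w (toℕ i ⊕[ n ] c)) ≡ h ((toℕ i + c) % n)
      step w h eq i c = trans (eq _) (cong h (toℕ-fromℕ< _))
      rim-at : ∀ (i : Fin n) → lookup S (u i) ∨ lookup S (u (toℕ i ⊕[ n ] 1)) ≡ true
      rim-at i = subst₂ (λ a b → a ∨ b ≡ true) (sym (lookup-outer i)) (sym (step u f lookup-outer i 1)) (rim (toℕ i) (toℕ<n i))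
      spoke-at : ∀ (i : Fin n) → lookup S (u i) ∨ lookup S (v i) ≡ true
      spoke-at i = subst₂ (λ a b → a ∨ b ≡ true) (sym (lookup-outer i)) (sym (lookup-inner i)) (spoke (toℕ i) (toℕ<n i))
      hub-at : ∀ (i : Fin n) → lookup S (v i) ∨ lookup S (v (toℕ i ⊕[ n ] k)) ≡ true
      hub-at i = subst₂ (λ a b → a ∨ b ≡ true) (sym (lookup-inner i)) (sym (step v g lookup-inner i k)) (hub (toℕ i) (toℕ<n i))

  small-cover : ∀ S → IsVertexCover (petersenEdges n k) S → size S < n + 2 → ¬ βP≥ n k (n + 2)
  small-cover S cov small β = <⇒≱ small (β S cov)

even-odd-cover : ∀ n k {{_ : NonZero n}} → odd n ≡ false → odd k ≡ true → ¬ βP≥ n k (n + 2)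
even-odd-cover n k even-n odd-k = small-cover S (S-cover rim spoke hub)
  (subst (_< n + 2) (sym (trans size-S (trans (+-comm (count n (not ∘ odd)) (count n odd)) (count-complement n odd)))) (m<m+n n (s≤s z≤n)))
  where
  open Petersen n k
  open FromSequences (not ∘ odd) odd
  rim : ∀ x → x < n → not (odd x) ∨ not (odd ((x + 1) % n)) ≡ true
  rim x _ = subst (λ b → not (odd x) ∨ not b ≡ true) (sym (trans (odd-mod even-n (x + 1)) (odd-+1 x)))
                  (∨-inverseʳ (not (odd x)))
  spoke : ∀ x → x < n → not (odd x) ∨ odd x ≡ true
  spoke x _ = ∨-inverseˡ (odd x)
  hub : ∀ x → x < n → odd x ∨ odd ((x + k) % n) ≡ true
  hub x _ = subst (λ b → odd x ∨ b ≡ true)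
    (sym (trans (odd-mod even-n (x + k)) (trans (odd-+ x k) (trans (cong (odd x xor_) odd-k) (xor-comm (odd x) true)))))
    (∨-inverseʳ (odd x))

unit-step-cover : ∀ {n k} {{_ : NonZero n}} → k ≡ 1 → ¬ βP≥ n k (n + 2)
unit-step-cover {n} refl = small-cover S (S-cover rim spoke hub)
  (subst (_< n + 2) (sym size-S) (≤-<-trans (≤-reflexive (count-∨ n (not ∘ odd) g spoke′))
    (+-monoʳ-< n (s≤s (≤-trans (count-mono n at-zero) (count-origin n))))))
  where
  open Petersen n 1
  g : ℕ → Bool
  g x = odd x ∨ (x ≡ᵇ 0)
  open FromSequences (not ∘ odd) g
  spoke′ : ∀ x → not (odd x) ∨ g x ≡ true
  spoke′ x with odd x
  ... | true  = refl
  ... | false = refl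
  spoke : ∀ x → x < n → not (odd x) ∨ g x ≡ true
  spoke x _ = spoke′ x
  rim : ∀ x → x < n → not (odd x) ∨ not (odd ((x + 1) % n)) ≡ true
  rim x x<n with step-mod x<n
  ... | inj₁ no-wrap = subst (λ y → not (odd x) ∨ not (odd y) ≡ true) (sym no-wrap)
                         (subst (λ b → not (odd x) ∨ not b ≡ true) (sym (odd-+1 x)) (∨-inverseʳ (not (odd x))))
  ... | inj₂ wrap    = subst (λ y → not (odd x) ∨ not (odd y) ≡ true) (sym wrap) (∨-zeroʳ (not (odd x)))
  hub : ∀ x → x < n → g x ∨ g ((x + 1) % n) ≡ true
  hub x x<n with step-mod x<n
  ... | inj₁ no-wrap = subst (λ y → g x ∨ g y ≡ true) (sym no-wrap)
                         (subst (λ b → g x ∨ (b ∨ ((x + 1) ≡ᵇ 0)) ≡ true) (sym (odd-+1 x)) (alternate (odd x)))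
    where
    alternate : ∀ b → (b ∨ (x ≡ᵇ 0)) ∨ (not b ∨ ((x + 1) ≡ᵇ 0)) ≡ true
    alternate true  = refl
    alternate false = ∨-zeroʳ _
  ... | inj₂ wrap    = subst (λ y → g x ∨ g y ≡ true) (sym wrap) (∨-zeroʳ (g x))
  at-zero : ∀ x → not (odd x) ∧ g x ≡ true → (x ≡ᵇ 0) ≡ true
  at-zero x both with odd x | both
  ... | false | h = h
  count-origin : ∀ m → count m (_≡ᵇ 0) ≤ 1
  count-origin zero    = z≤n
  count-origin (suc m) = s≤s (≤-reflexive (count-false m))

-- (c) (n, k) = (5, 2): {u₁, u₃, u₄, v₀, v₁, v₂}, with six vertices, is a vertex cover.
five-two-cover : ∀ {n k} {{_ : NonZero n}} → n ≡ 5 → k ≡ 2 → ¬ βP≥ n k (n + 2)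
five-two-cover refl refl = small-cover S₅₂ (toWitness {a? = all? covers? (petersenEdges 5 2)} tt) ≤-refl
  where
  open Petersen 5 2
  S₅₂ : Subset 10
  S₅₂ = false ∷ true ∷ false ∷ true ∷ true ∷ true ∷ true ∷ true ∷ false ∷ false ∷ []
  covers? : ∀ (e : Fin 10 × Fin 10) → Dec ((proj₁ e ∈ S₅₂) ⊎ (proj₂ e ∈ S₅₂))
  covers? (a , b) = (a ∈? S₅₂) ⊎-dec (b ∈? S₅₂)

exceptional⇒small-cover : ∀ n k {{_ : NonZero n}} → Exceptional n k → ¬ βP≥ n k (n + 2)
exceptional⇒small-cover n k (inj₁ (2∣n , 2∤k))        = even-odd-cover n k (2∣⇒even 2∣n) (2∤⇒odd k 2∤k)
exceptional⇒small-cover n k (inj₂ (inj₁ (_ , k≡1)))   = unit-step-cover k≡1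
exceptional⇒small-cover n k (inj₂ (inj₂ (n≡5 , k≡2))) = five-two-cover n≡5 k≡2

-- Otherwise every vertex cover S doubly covers two spokes, so |S| = n + #spoke ≥ n + 2.
regular⇒large-cover : ∀ n k {{_ : NonZero n}} → 0 < k → 2 * k < n → ¬ Exceptional n k → βP≥ n k (n + 2)
regular⇒large-cover n k 0<k 2k<n regular S cov = begin
  n + 2                ≤⟨ +-monoʳ-≤ n (≮⇒≥ λ #spoke<2 → regular (few-spokeDoubles 0<k (double-below {n} {k} 2k<n) (s≤s⁻¹ #spoke<2))) ⟩
  n + #spoke           ≡⟨ spoke-count ⟨
  #outer + #inner      ≡⟨ size-rings S ⟨
  size S               ∎
  where
  open ≤-Reasoning
  open Petersen n k
  open CoverAnalysis (toPeriodicCover S cov)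

corollary16 : (n k : ℕ) → 1 ≤ k → (n>2k : 2 * k < n) → {{_ : NonZero n}} →
    βP≥ n k (n + 2) ⇔ (¬ ((2 ∣ n × (¬ 2 ∣ k)) ⊎ ((¬ 2 ∣ n) × k ≡ 1) ⊎ (n ≡ 5 × k ≡ 2)))
corollary16 n k 1≤k n>2k =
  mk⇔ (λ β exceptional → exceptional⇒small-cover n k exceptional β) (regular⇒large-cover n k 1≤k n>2k)
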